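{- Let $G$ be a finite group, $\rho:G\to\mathrm{GL}_2(\overline{\mathbb F}_5)$ an absolutely irreducible representation with $\rho(G)\subset\mathrm{GL}_2(\mathbb F_5)$, and $\mu:G\to\overline{\mathbb F}_5^\times$ a character of even order. Assume $G$ contains an element $c$ of order $2$ with $\mu(c)=-1$. Then it is not the case that the projective image of $\rho$ is isomorphic to $\mathrm{PGL}_2(\mathbb F_5)$ and $\mu$ factors through the character of order $2$ of $\mathrm{PGL}_2(\mathbb F_5)$ (via $G\to\mathrm{PGL}_2(\mathbb F_5)$).
   Context: The projective image of $\rho$ is the image of $G$ in $\mathrm{PGL}_2(\overline{\mathbb F}_5)$ under $\rho$. -}

module Defs where

open import Level using (0ℓ)
open import Algebra.Bundles using (Group; CommutativeRing)
open import Data.Nat as ℕ using (ℕ; zero; suc)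
open import Data.Nat.Divisibility using (_∣_)
open import Data.Nat using (_<_)
open import Data.Nat.DivMod using (_mod_)
open import Data.Fin using (Fin; toℕ; zero; suc)
open import Data.List using (List; []; _∷_; length)
open import Data.Product using (Σ; ∃; _×_; _,_; proj₁)
open import Data.Sum using (_⊎_)
open import Relation.Nullary using (¬_)
open import Relation.Binary.PropositionalEquality using (_≡_; _≢_; refl; sym; cong₂)

F₅ : Set
F₅ = Fin 5

_+₅_ : F₅ → F₅ → F₅
infixl 6 _+₅_ _-₅_
infixl 7 _*₅_

x +₅ y = (toℕ x ℕ.+ toℕ y) mod 5

_*₅_ : F₅ → F₅ → F₅
x *₅ y = (toℕ x ℕ.* toℕ y) mod 5

-₅_ : F₅ → F₅
-₅ x = ((5 ℕ.∸ toℕ x)) mod 5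

_-₅_ : F₅ → F₅ → F₅
x -₅ y = x +₅ (-₅ y)

one₅ : F₅
one₅ = suc zero

*₅-identityˡ : ∀ x → one₅ *₅ x ≡ x
*₅-identityˡ zero = refl
*₅-identityˡ (suc zero) = refl
*₅-identityˡ (suc (suc zero)) = refl
*₅-identityˡ (suc (suc (suc zero))) = refl
*₅-identityˡ (suc (suc (suc (suc zero)))) = refl

record Mat₂ : Set where
  constructor mat
  field
    a b c d : F₅
open Mat₂ public

_·ᴹ_ : Mat₂ → Mat₂ → Mat₂
M ·ᴹ N = mat (a M *₅ a N +₅ b M *₅ c N) (a M *₅ b N +₅ b M *₅ d N)
            (c M *₅ a N +₅ d M *₅ c N) (c M *₅ b N +₅ d M *₅ d N)

det : Mat₂ → F₅
det M = a M *₅ d M -₅ b M *₅ c M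

InGL₂ : Mat₂ → Set
InGL₂ M = det M ≢ zero

scale : F₅ → Mat₂ → Mat₂
scale λ' M = mat (λ' *₅ a M) (λ' *₅ b M) (λ' *₅ c M) (λ' *₅ d M)

-- PGL₂(F₅) = GL₂(F₅) / scalars, presented as GL₂(F₅) with the setoid
-- equality "equal up to a nonzero scalar".
_∼_ : Mat₂ → Mat₂ → Set
M ∼ N = Σ F₅ λ λ' → (λ' ≢ zero) × (M ≡ scale λ' N)

scale-one : ∀ M → scale one₅ M ≡ M
scale-one (mat x y z w) rewrite *₅-identityˡ x | *₅-identityˡ y
                              | *₅-identityˡ z | *₅-identityˡ w = refl

∼-refl : ∀ M → M ∼ M
∼-refl M = one₅ , (λ ()) , sym (scale-one M)

-- Algebraically closed fields of characteristic 5 (standing in for F̄₅)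

module _ (K : CommutativeRing 0ℓ 0ℓ) where
  open CommutativeRing K

  natK : ℕ → Carrier
  natK zero    = 0#
  natK (suc n) = 1# + natK n

  powK : Carrier → ℕ → Carrier
  powK x zero    = 1#
  powK x (suc n) = x * powK x n

  evalP : List Carrier → Carrier → Carrier
  evalP []       x = 0#
  evalP (a ∷ as) x = a + x * evalP as x

  record IsAlgClosedFieldChar5 : Set where
    field
      nontrivial  : ¬ (1# ≈ 0#)
      inverses    : ∀ x → ¬ (x ≈ 0#) → ∃ λ y → x * y ≈ 1#
      char5       : natK 5 ≈ 0#
      -- every monic polynomial x^n + a_{n-1}x^{n-1} + … + a₀ with n ≥ 1 has a root
      algClosed   : ∀ (as : List Carrier) → as ≢ [] →
                    ∃ λ x → powK x (length as) + evalP as x ≈ 0#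

  ι : F₅ → Carrier
  ι x = natK (toℕ x)

  -- the character of order 2 of PGL₂(F₅): det modulo squares
  -- (squares in F₅^× are 1, 4; non-squares 2, 3)
  sgnDet : F₅ → Carrier
  sgnDet (suc (suc zero))       = - 1#
  sgnDet (suc (suc (suc zero))) = - 1#
  sgnDet _                      = 1#

  χ : Mat₂ → Carrier
  χ M = sgnDet (det M)

module _ (G : Group 0ℓ 0ℓ) where
  open Group G

  IsFiniteGroup : Set
  IsFiniteGroup = Σ ℕ λ n → Σ (Fin n → Carrier) λ e → ∀ g → ∃ λ i → e i ≈ g

  HasOrder2 : Carrier → Set
  HasOrder2 c = ¬ (c ≈ ε) × (c ∙ c ≈ ε)

  record IsRepGL₂F₅ (ρ : Carrier → Mat₂) : Set where
    field
      inGL     : ∀ g → InGL₂ (ρ g)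
      resp     : ∀ {g h} → g ≈ h → ρ g ≡ ρ h
      hom      : ∀ g h → ρ (g ∙ h) ≡ ρ g ·ᴹ ρ h

  InProjImage : (Carrier → Mat₂) → Mat₂ → Set
  InProjImage ρ M = ∃ λ g → ρ g ∼ M

  record ProjImageIso (ρ : Carrier → Mat₂) : Set where
    field
      φ     : (M : Mat₂) → InProjImage ρ M → Mat₂
      inGL  : ∀ M p → InGL₂ (φ M p)
      resp  : ∀ M N p q → M ∼ N → φ M p ∼ φ N q
      hom   : ∀ M N p q r → φ (M ·ᴹ N) r ∼ (φ M p ·ᴹ φ N q)
      inj   : ∀ M N p q → φ M p ∼ φ N q → M ∼ N
      surj  : ∀ N → InGL₂ N → Σ Mat₂ λ M → Σ (InProjImage ρ M) λ p → φ M p ∼ N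

  module _ (K : CommutativeRing 0ℓ 0ℓ) where
    private module K = CommutativeRing K

    -- absolutely irreducible: no G-stable line in F̄₅², i.e. no common
    -- eigenvector (v₁, v₂) ≠ 0 of all ρ(g) over the algebraically closed K
    IsAbsIrred : (Carrier → Mat₂) → Set
    IsAbsIrred ρ = ¬ (Σ K.Carrier λ v₁ → Σ K.Carrier λ v₂ →
        (¬ (v₁ K.≈ K.0#) ⊎ ¬ (v₂ K.≈ K.0#)) ×
        (∀ g → ∃ λ t →
           ((ι K (a (ρ g)) K.* v₁ K.+ ι K (b (ρ g)) K.* v₂) K.≈ t K.* v₁) ×
           ((ι K (c (ρ g)) K.* v₁ K.+ ι K (d (ρ g)) K.* v₂) K.≈ t K.* v₂)))

    record IsCharacter (μ : Carrier → K.Carrier) : Set where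
      field
        unit : ∀ g → ∃ λ y → μ g K.* y K.≈ K.1#
        resp : ∀ {g h} → g ≈ h → μ g K.≈ μ h
        hom  : ∀ g h → μ (g ∙ h) K.≈ μ g K.* μ h

    CharHasOrder : (Carrier → K.Carrier) → ℕ → Set
    CharHasOrder μ n = (0 < n) × (∀ g → powK K (μ g) n K.≈ K.1#) ×
      (∀ m → 0 < m → m < n → ¬ (∀ g → powK K (μ g) m K.≈ K.1#))

    HasEvenOrder : (Carrier → K.Carrier) → Set
    HasEvenOrder μ = ∃ λ n → CharHasOrder μ n × (2 ∣ n)

module Submission where

-- Under PGL₂(F₅) ≅ S₅ the character χ is the sign: an element is odd iff its
-- determinant is a non-square. Since ρ(c)² = 1, det ρ(c) = ±1 is a square, while
-- χ(φ[ρ(c)]) = μ(c) = -1 makes the involution φ[ρ(c)] odd. Oddness of an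
-- involution is intrinsic to the abstract group: the odd involutions of PGL₂(F₅)
-- are exactly the cubes of elements of order 6. Pulling such an R with
-- R³ = φ[ρ(c)] back along φ gives X of order 6 with X³ = [ρ(c)], so [ρ(c)] is
-- odd after all. The facts about PGL₂(F₅) are decided by enumerating its
-- 625 matrices.

open import Defs
open import Level using (0ℓ)
open import Algebra.Bundles using (Group; CommutativeRing)
open import Data.Bool using (Bool; true; false)
open import Data.Bool.Properties using () renaming (_≟_ to _≟ᴮ_)
open import Data.Empty using (⊥-elim)
open import Data.Fin using (zero; suc)
open import Data.Fin.Properties using (all?; any?) renaming (_≟_ to _≟ᶠ_)
open import Data.Product using (Σ; ∃; _×_; _,_)
open import Relation.Binary.PropositionalEquality
  using (_≡_; _≢_; refl; sym; trans; cong; cong₂; subst; module ≡-Reasoning)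
open import Relation.Nullary using (¬_; Dec; yes; no)
open import Relation.Nullary.Decidable using (toWitness; _×-dec_; _→-dec_; ¬?; map′)

Id : Mat₂
Id = mat one₅ zero zero one₅

cube : Mat₂ → Mat₂
cube X = (X ·ᴹ X) ·ᴹ X

isSquare₅ : F₅ → Bool
isSquare₅ (suc (suc zero))       = false
isSquare₅ (suc (suc (suc zero))) = false
isSquare₅ _                      = true

HasOrder6 : Mat₂ → Set
HasOrder6 X = ((cube X ·ᴹ cube X) ∼ Id) × ¬ ((X ·ᴹ X) ∼ Id) × ¬ (cube X ∼ Id)

_≟ᴹ_ : (M N : Mat₂) → Dec (M ≡ N)
mat a b c d ≟ᴹ mat a' b' c' d' with a ≟ᶠ a' | b ≟ᶠ b' | c ≟ᶠ c' | d ≟ᶠ d'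
... | yes refl | yes refl | yes refl | yes refl = yes refl
... | no a≢a'  | _        | _        | _        = no λ { refl → a≢a' refl }
... | yes _    | no b≢b'  | _        | _        = no λ { refl → b≢b' refl }
... | yes _    | yes _    | no c≢c'  | _        = no λ { refl → c≢c' refl }
... | yes _    | yes _    | yes _    | no d≢d'  = no λ { refl → d≢d' refl }

_∼?_ : (M N : Mat₂) → Dec (M ∼ N)
M ∼? N = any? λ λ' → ¬? (λ' ≟ᶠ zero) ×-dec (M ≟ᴹ scale λ' N)

all-Mat₂? : {P : Mat₂ → Set} → (∀ M → Dec (P M)) → Dec (∀ M → P M)
all-Mat₂? P? = map′ (λ h → λ { (mat a b c d) → h a b c d }) (λ h a b c d → h (mat a b c d))
  (all? λ a → all? λ b → all? λ c → all? λ d → P? (mat a b c d))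

any-Mat₂? : {P : Mat₂ → Set} → (∀ M → Dec (P M)) → Dec (∃ P)
any-Mat₂? P? = map′ (λ { (a , b , c , d , p) → mat a b c d , p })
                    (λ { (mat a b c d , p) → a , b , c , d , p })
  (any? λ a → any? λ b → any? λ c → any? λ d → P? (mat a b c d))

-- 'abstract' keeps Agda from unfolding these enumeration proofs at their use sites.
abstract
  *₅-assoc : ∀ x y z → x *₅ (y *₅ z) ≡ (x *₅ y) *₅ z
  *₅-assoc = toWitness {a? = all? λ x → all? λ y → all? λ z →
    (x *₅ (y *₅ z)) ≟ᶠ ((x *₅ y) *₅ z)} _

  *₅-interchange : ∀ x y z w → (x *₅ y) *₅ (z *₅ w) ≡ (x *₅ z) *₅ (y *₅ w)
  *₅-interchange = toWitness {a? = all? λ x → all? λ y → all? λ z → all? λ w →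
    ((x *₅ y) *₅ (z *₅ w)) ≟ᶠ ((x *₅ z) *₅ (y *₅ w))} _

  *₅-distribˡ-+₅ : ∀ x y z → x *₅ (y +₅ z) ≡ x *₅ y +₅ x *₅ z
  *₅-distribˡ-+₅ = toWitness {a? = all? λ x → all? λ y → all? λ z →
    (x *₅ (y +₅ z)) ≟ᶠ (x *₅ y +₅ x *₅ z)} _

  *₅-≢0 : ∀ x y → x ≢ zero → y ≢ zero → x *₅ y ≢ zero
  *₅-≢0 = toWitness {a? = all? λ x → all? λ y →
    ¬? (x ≟ᶠ zero) →-dec (¬? (y ≟ᶠ zero) →-dec ¬? ((x *₅ y) ≟ᶠ zero))} _

  *₅-inverseˡ : ∀ x → x ≢ zero → ∃ λ y → (y ≢ zero) × (y *₅ x ≡ one₅)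
  *₅-inverseˡ = toWitness {a? = all? λ x → ¬? (x ≟ᶠ zero) →-dec
    any? λ y → ¬? (y ≟ᶠ zero) ×-dec ((y *₅ x) ≟ᶠ one₅)} _

  det-scale-≢0 : ∀ λ' M → λ' ≢ zero → InGL₂ M → InGL₂ (scale λ' M)
  det-scale-≢0 = toWitness {a? = all? λ λ' → all-Mat₂? λ M → ¬? (λ' ≟ᶠ zero) →-dec
    (¬? (det M ≟ᶠ zero) →-dec ¬? (det (scale λ' M) ≟ᶠ zero))} _

  isSquare₅-det-scale : ∀ λ' M → λ' ≢ zero → isSquare₅ (det (scale λ' M)) ≡ isSquare₅ (det M)
  isSquare₅-det-scale = toWitness {a? = all? λ λ' → all-Mat₂? λ M → ¬? (λ' ≟ᶠ zero) →-dec
    (isSquare₅ (det (scale λ' M)) ≟ᴮ isSquare₅ (det M))} _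

  idempotent⇒≡Id : ∀ M → InGL₂ M → M ·ᴹ M ≡ M → M ≡ Id
  idempotent⇒≡Id = toWitness {a? = all-Mat₂? λ M → ¬? (det M ≟ᶠ zero) →-dec
    ((M ·ᴹ M) ≟ᴹ M →-dec (M ≟ᴹ Id))} _

  involution⇒isSquare₅-det : ∀ M → M ·ᴹ M ≡ Id → isSquare₅ (det M) ≡ true
  involution⇒isSquare₅-det = toWitness {a? = all-Mat₂? λ M →
    (M ·ᴹ M) ≟ᴹ Id →-dec (isSquare₅ (det M) ≟ᴮ true)} _

  ∼-idempotent⇒∼Id : ∀ M → InGL₂ M → M ∼ (M ·ᴹ M) → M ∼ Id
  ∼-idempotent⇒∼Id = toWitness {a? = all-Mat₂? λ M → ¬? (det M ≟ᶠ zero) →-dec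
    ((M ∼? (M ·ᴹ M)) →-dec (M ∼? Id))} _

  odd-involution⇒cube-of-order6 : ∀ T → InGL₂ T → (T ·ᴹ T) ∼ Id → isSquare₅ (det T) ≡ false →
    ∃ λ R → InGL₂ R × HasOrder6 R × cube R ∼ T
  odd-involution⇒cube-of-order6 = toWitness {a? = all-Mat₂? λ T → ¬? (det T ≟ᶠ zero) →-dec
    (((T ·ᴹ T) ∼? Id) →-dec ((isSquare₅ (det T) ≟ᴮ false) →-dec any-Mat₂? λ R →
      ¬? (det R ≟ᶠ zero) ×-dec ((((cube R ·ᴹ cube R) ∼? Id) ×-dec ¬? ((R ·ᴹ R) ∼? Id)
      ×-dec ¬? (cube R ∼? Id)) ×-dec (cube R ∼? T))))} _

  order6⇒odd-cube : ∀ X → InGL₂ X → HasOrder6 X → isSquare₅ (det (cube X)) ≡ false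
  order6⇒odd-cube = toWitness {a? = all-Mat₂? λ X → ¬? (det X ≟ᶠ zero) →-dec
    ((((cube X ·ᴹ cube X) ∼? Id) ×-dec ¬? ((X ·ᴹ X) ∼? Id) ×-dec ¬? (cube X ∼? Id)) →-dec
      (isSquare₅ (det (cube X)) ≟ᴮ false))} _

mat-cong : ∀ {a b c d a' b' c' d'} → a ≡ a' → b ≡ b' → c ≡ c' → d ≡ d' →
           mat a b c d ≡ mat a' b' c' d'
mat-cong refl refl refl refl = refl

scale-scale : ∀ λ' κ M → scale λ' (scale κ M) ≡ scale (λ' *₅ κ) M
scale-scale λ' κ (mat a b c d) =
  mat-cong (*₅-assoc λ' κ a) (*₅-assoc λ' κ b) (*₅-assoc λ' κ c) (*₅-assoc λ' κ d)

scale-·ᴹ : ∀ λ' κ M N → scale λ' M ·ᴹ scale κ N ≡ scale (λ' *₅ κ) (M ·ᴹ N)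
scale-·ᴹ λ' κ (mat a b c d) (mat x y z w) =
  mat-cong (entry a b x z) (entry a b y w) (entry c d x z) (entry c d y w)
  where
  entry : ∀ p q r s → (λ' *₅ p) *₅ (κ *₅ r) +₅ (λ' *₅ q) *₅ (κ *₅ s)
                    ≡ (λ' *₅ κ) *₅ (p *₅ r +₅ q *₅ s)
  entry p q r s = trans (cong₂ _+₅_ (*₅-interchange λ' p κ r) (*₅-interchange λ' q κ s))
                        (sym (*₅-distribˡ-+₅ (λ' *₅ κ) (p *₅ r) (q *₅ s)))

≡⇒∼ : ∀ {M N} → M ≡ N → M ∼ N
≡⇒∼ {M} refl = ∼-refl M

∼-sym : ∀ {M N} → M ∼ N → N ∼ M
∼-sym {M} {N} (λ' , λ'≢0 , M≡λ'N) with *₅-inverseˡ λ' λ'≢0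
... | κ , κ≢0 , κλ'≡1 = κ , κ≢0 , sym (begin
  scale κ M             ≡⟨ cong (scale κ) M≡λ'N ⟩
  scale κ (scale λ' N)  ≡⟨ scale-scale κ λ' N ⟩
  scale (κ *₅ λ') N     ≡⟨ cong (λ μ' → scale μ' N) κλ'≡1 ⟩
  scale one₅ N          ≡⟨ scale-one N ⟩
  N                     ∎)
  where open ≡-Reasoning

∼-trans : ∀ {M N P} → M ∼ N → N ∼ P → M ∼ P
∼-trans {P = P} (λ' , λ'≢0 , refl) (κ , κ≢0 , refl) =
  λ' *₅ κ , *₅-≢0 λ' κ λ'≢0 κ≢0 , scale-scale λ' κ P

·ᴹ-cong : ∀ {M M' N N'} → M ∼ M' → N ∼ N' → (M ·ᴹ N) ∼ (M' ·ᴹ N')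
·ᴹ-cong {M' = M'} {N' = N'} (λ' , λ'≢0 , refl) (κ , κ≢0 , refl) =
  λ' *₅ κ , *₅-≢0 λ' κ λ'≢0 κ≢0 , scale-·ᴹ λ' κ M' N'

InGL₂-resp : ∀ {M N} → M ∼ N → InGL₂ N → InGL₂ M
InGL₂-resp {N = N} (λ' , λ'≢0 , refl) = det-scale-≢0 λ' N λ'≢0

isSquare₅-det-resp : ∀ {M N} → M ∼ N → isSquare₅ (det M) ≡ isSquare₅ (det N)
isSquare₅-det-resp {N = N} (λ' , λ'≢0 , refl) = isSquare₅-det-scale λ' N λ'≢0

module _ (K : CommutativeRing 0ℓ 0ℓ) (AC : IsAlgClosedFieldChar5 K) where
  open CommutativeRing K
    using (_≈_; _+_; -_; 0#; 1#; setoid; +-congˡ; +-congʳ; +-assoc; +-identityˡ; +-identityʳ;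
           -‿inverseʳ)
    renaming (sym to ≈-sym; trans to ≈-trans)
  open IsAlgClosedFieldChar5 AC using (nontrivial; char5)
  open import Relation.Binary.Reasoning.Setoid setoid

  1≉-1 : ¬ (1# ≈ - 1#)
  1≉-1 1≈-1 = nontrivial (begin
    1#          ≈⟨ ≈-sym (+-identityʳ 1#) ⟩
    natK K 1    ≈⟨ ≈-sym (add-two (natK K 1)) ⟩
    natK K 3    ≈⟨ ≈-sym (add-two (natK K 3)) ⟩
    natK K 5    ≈⟨ char5 ⟩
    0#          ∎)
    where
    add-two : ∀ x → 1# + (1# + x) ≈ x
    add-two x = begin
      1# + (1# + x)  ≈⟨ ≈-sym (+-assoc 1# 1# x) ⟩
      (1# + 1#) + x  ≈⟨ +-congʳ (≈-trans (+-congˡ 1≈-1) (-‿inverseʳ 1#)) ⟩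
      0# + x         ≈⟨ +-identityˡ x ⟩
      x              ∎

  sgnDet≈-1⇒nonsquare : ∀ x → sgnDet K x ≈ - 1# → isSquare₅ x ≡ false
  sgnDet≈-1⇒nonsquare zero                             1≈-1 = ⊥-elim (1≉-1 1≈-1)
  sgnDet≈-1⇒nonsquare (suc zero)                       1≈-1 = ⊥-elim (1≉-1 1≈-1)
  sgnDet≈-1⇒nonsquare (suc (suc zero))                 _    = refl
  sgnDet≈-1⇒nonsquare (suc (suc (suc zero)))           _    = refl
  sgnDet≈-1⇒nonsquare (suc (suc (suc (suc zero))))     1≈-1 = ⊥-elim (1≉-1 1≈-1)

module Representation {G : Group 0ℓ 0ℓ} {ρ : Group.Carrier G → Mat₂} (rep : IsRepGL₂F₅ G ρ) where
  open Group G using (_≈_; _∙_; ε; identityˡ)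
  open IsRepGL₂F₅ rep renaming (inGL to ρ-inGL; resp to ρ-resp; hom to ρ-hom)

  ρ-ε-idempotent : ρ ε ·ᴹ ρ ε ≡ ρ ε
  ρ-ε-idempotent = trans (sym (ρ-hom ε ε)) (ρ-resp (identityˡ ε))

  ρ-ε≡Id : ρ ε ≡ Id
  ρ-ε≡Id = idempotent⇒≡Id (ρ ε) (ρ-inGL ε) ρ-ε-idempotent

  ρ-involution : ∀ {g} → g ∙ g ≈ ε → ρ g ·ᴹ ρ g ≡ Id
  ρ-involution {g} gg≈ε = trans (sym (ρ-hom g g)) (trans (ρ-resp gg≈ε) ρ-ε≡Id)

  [_] : ∀ g → InProjImage G ρ (ρ g)
  [ g ] = g , ∼-refl (ρ g)

  _·ᵖ_ : ∀ {M N} → InProjImage G ρ M → InProjImage G ρ N → InProjImage G ρ (M ·ᴹ N)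
  (g , ρg∼M) ·ᵖ (h , ρh∼N) = g ∙ h , subst (_∼ _) (sym (ρ-hom g h)) (·ᴹ-cong ρg∼M ρh∼N)

  InProjImage⇒InGL₂ : ∀ {M} → InProjImage G ρ M → InGL₂ M
  InProjImage⇒InGL₂ (g , ρg∼M) = InGL₂-resp (∼-sym ρg∼M) (ρ-inGL g)

  module ProjIso (I : ProjImageIso G ρ) where
    open ProjImageIso I public using (φ; inj; surj) renaming (inGL to φ-inGL)
    open ProjImageIso I using (resp; hom)

    φ-ε∼Id : φ (ρ ε) [ ε ] ∼ Id
    φ-ε∼Id = ∼-idempotent⇒∼Id (φ (ρ ε) [ ε ]) (φ-inGL _ _)
      (∼-trans (resp _ _ [ ε ] ε² (≡⇒∼ (sym ρ-ε-idempotent))) (hom _ _ [ ε ] [ ε ] ε²))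
      where
      ε² : InProjImage G ρ (ρ ε ·ᴹ ρ ε)
      ε² = [ ε ] ·ᵖ [ ε ]

    φ-∼Id : ∀ {M} p → M ∼ Id → φ M p ∼ Id
    φ-∼Id {M} p M∼Id = ∼-trans (resp M (ρ ε) p [ ε ] (∼-trans M∼Id (≡⇒∼ (sym ρ-ε≡Id)))) φ-ε∼Id

    φ-∼Id⁻¹ : ∀ {M} p → φ M p ∼ Id → M ∼ Id
    φ-∼Id⁻¹ {M} p φM∼Id =
      ∼-trans (inj M (ρ ε) p [ ε ] (∼-trans φM∼Id (∼-sym φ-ε∼Id))) (≡⇒∼ ρ-ε≡Id)

    φ-square : ∀ {M R} p q → φ M p ∼ R → φ (M ·ᴹ M) q ∼ (R ·ᴹ R)
    φ-square {M} p q φM∼R = ∼-trans (hom M M p p q) (·ᴹ-cong φM∼R φM∼R)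

    φ-cube : ∀ {M R} p q → φ M p ∼ R → φ (cube M) q ∼ cube R
    φ-cube {M} p q φM∼R =
      ∼-trans (hom (M ·ᴹ M) M (p ·ᵖ p) p q) (·ᴹ-cong (φ-square p (p ·ᵖ p) φM∼R) φM∼R)

    HasOrder6-reflect : ∀ {M R} p → φ M p ∼ R → HasOrder6 R → HasOrder6 M
    HasOrder6-reflect {M} {R} p φM∼R (R⁶∼Id , R²≁Id , R³≁Id) =
        φ-∼Id⁻¹ (p³ ·ᵖ p³) (∼-trans (φ-square p³ (p³ ·ᵖ p³) (φ-cube p p³ φM∼R)) R⁶∼Id)
      , (λ M²∼Id → R²≁Id (∼-trans (∼-sym (φ-square p p² φM∼R)) (φ-∼Id p² M²∼Id)))
      , (λ M³∼Id → R³≁Id (∼-trans (∼-sym (φ-cube p p³ φM∼R)) (φ-∼Id p³ M³∼Id)))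
      where
      p² : InProjImage G ρ (M ·ᴹ M)
      p² = p ·ᵖ p
      p³ : InProjImage G ρ (cube M)
      p³ = p² ·ᵖ p

    φ-involution : ∀ {D} p → (D ·ᴹ D) ∼ Id → (φ D p ·ᴹ φ D p) ∼ Id
    φ-involution {D} p D²∼Id =
      ∼-trans (∼-sym (φ-square p (p ·ᵖ p) (∼-refl (φ D p)))) (φ-∼Id (p ·ᵖ p) D²∼Id)

    φ-reflects-odd-involution : ∀ {D} p → (D ·ᴹ D) ∼ Id →
      isSquare₅ (det (φ D p)) ≡ false → isSquare₅ (det D) ≡ false
    -- Local functions instead of 'with': abstracting the goal isSquare₅ (det D) exhausts memory.
    φ-reflects-odd-involution {D} p D²∼Id φD-odd =
      pull-back (odd-involution⇒cube-of-order6 (φ D p) (φ-inGL D p) (φ-involution p D²∼Id) φD-odd)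
      where
      pull-back : (∃ λ R → InGL₂ R × HasOrder6 R × cube R ∼ φ D p) → isSquare₅ (det D) ≡ false
      pull-back (R , R-inGL , R-order6 , R³∼φD) = odd-cube (surj R R-inGL)
        where
        odd-cube : (Σ Mat₂ λ X → Σ (InProjImage G ρ X) λ q → φ X q ∼ R) → isSquare₅ (det D) ≡ false
        odd-cube (X , q , φX∼R) = trans (sym (isSquare₅-det-resp X³∼D))
          (order6⇒odd-cube X (InProjImage⇒InGL₂ q) (HasOrder6-reflect q φX∼R R-order6))
          where
          q³ : InProjImage G ρ (cube X)
          q³ = (q ·ᵖ q) ·ᵖ q
          X³∼D : cube X ∼ D
          X³∼D = inj (cube X) D q³ p (∼-trans (φ-cube q q³ φX∼R) R³∼φD)

proposition9p1p2 : (G : Group 0ℓ 0ℓ) → IsFiniteGroup G →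
    (K : CommutativeRing 0ℓ 0ℓ) → IsAlgClosedFieldChar5 K →
    (ρ : Group.Carrier G → Mat₂) → IsRepGL₂F₅ G ρ → IsAbsIrred G K ρ →
    (μ : Group.Carrier G → CommutativeRing.Carrier K) →
    IsCharacter G K μ → HasEvenOrder G K μ →
    (c : Group.Carrier G) → HasOrder2 G c →
    CommutativeRing._≈_ K (μ c) (CommutativeRing.-_ K (CommutativeRing.1# K)) →
    ¬ (Σ (ProjImageIso G ρ) λ I →
         ∀ g → CommutativeRing._≈_ K (μ g)
                 (χ K (ProjImageIso.φ I (ρ g) (g , ∼-refl (ρ g)))))
proposition9p1p2 G _ K AC ρ rep _ μ _ _ c (_ , c²≈ε) μc≈-1 (I , μ≈χφ) = true≢false (begin
  true                        ≡⟨ sym (involution⇒isSquare₅-det (ρ c) ρc²≡Id) ⟩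
  isSquare₅ (det (ρ c))       ≡⟨ φ-reflects-odd-involution [ c ] (≡⇒∼ ρc²≡Id) φρc-odd ⟩
  false                       ∎)
  where
  open Representation rep
  open ProjIso I
  open ≡-Reasoning
  ρc²≡Id : ρ c ·ᴹ ρ c ≡ Id
  ρc²≡Id = ρ-involution c²≈ε
  φρc-odd : isSquare₅ (det (φ (ρ c) [ c ])) ≡ false
  φρc-odd = sgnDet≈-1⇒nonsquare K AC _
    (CommutativeRing.trans K (CommutativeRing.sym K (μ≈χφ c)) μc≈-1)
  true≢false : true ≢ false
  true≢false ()
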